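{- Let $C$ be a binary self-orthogonal linear code of length $25$ and dimension $12$. Suppose $C$ contains $16$ codewords which are the rows of the augmented incidence matrix of a $(16,6,3)$-design. Then the minimum distance of $C$ is at least $4$, and $C$ has no all-0-coordinate.
   Context: A $(v,k,\lambda)$-design is a pair $(V,B)$ with $V$ a $v$-set and $B$ a collection of $b$ $k$-subsets (blocks) of $V$ such that each point lies in exactly $r$ blocks and each pair of points lies in exactly $\lambda$ blocks; for $(16,6,3)$ one has $r=9$, $b=24$. Its incidence matrix is the $v\times b$ $0/1$ matrix with rows indexed by points, columns by blocks, entry $1$ iff the point lies in the block. The augmented incidence matrix is the incidence matrix with one extra column consisting entirely of $1$'s appended (so for a $(16,6,3)$-design it is a $16\times 25$ binary matrix). A binary linear code $C\subseteq\mathbb{F}_2^n$ is self-orthogonal if $C\subseteq C^{\perp}$, where $C^\perp=\{x\in\mathbb{F}_2^n: x\cdot c=0 \text{ for all } c\in C\}$ (inner product mod 2). The minimum distance of a linear code is the minimum Hamming weight of a nonzero codeword. A coordinate position $j$ is an all-0-coordinate of $C$ if every codeword of $C$ has $0$ in position $j$. -}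

module Defs where

open import Data.Bool using (Bool; true; false; _∧_; _xor_; if_then_else_)
open import Data.Nat using (ℕ; zero; suc; _+_)
open import Data.Fin using (Fin; toℕ; fromℕ; inject₁)
open import Data.Fin.Patterns using (0F)
open import Data.Product using (Σ; _×_; ∃)
open import Relation.Binary.PropositionalEquality using (_≡_)
open import Relation.Nullary using (¬_)

-- Binary words of length n: vectors over F₂ = Bool (false = 0, true = 1).
Word : ℕ → Set
Word n = Fin n → Bool

zeroWord : ∀ {n} → Word n
zeroWord _ = false

xorSum : ∀ {n} → (Fin n → Bool) → Bool
xorSum {zero} f = false
xorSum {suc n} f = f Data.Fin.zero xor xorSum {n} (λ i → f (Data.Fin.suc i))

count : ∀ {n} → (Fin n → Bool) → ℕ
count {zero} f = 0
count {suc n} f = (if f Data.Fin.zero then 1 else 0) + count {n} (λ i → f (Data.Fin.suc i))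

weight : ∀ {n} → Word n → ℕ
weight = count

dot : ∀ {n} → Word n → Word n → Bool
dot x y = xorSum (λ i → x i ∧ y i)

lincomb : ∀ {k n} → (Fin k → Bool) → (Fin k → Word n) → Word n
lincomb m G j = xorSum (λ i → m i ∧ G i j)

-- A binary linear [n,k] code, given by a generator matrix: k linearly
-- independent rows in F₂ⁿ.  The code is their F₂-span, of dimension k.
record LinearCode (n k : ℕ) : Set where
  field
    gen : Fin k → Word n
    independent : ∀ (m : Fin k → Bool) → (∀ j → lincomb m gen j ≡ false) → ∀ i → m i ≡ false

_∈C_ : ∀ {n k} → Word n → LinearCode n k → Set
_∈C_ {n} {k} x C = ∃ λ (m : Fin k → Bool) → ∀ j → lincomb m (LinearCode.gen C) j ≡ x j

SelfOrthogonal : ∀ {n k} → LinearCode n k → Set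
SelfOrthogonal C = ∀ x y → x ∈C C → y ∈C C → dot x y ≡ false

MinDistAtLeast : ∀ {n k} → LinearCode n k → ℕ → Set
MinDistAtLeast C d = ∀ x → x ∈C C → ¬ (∀ j → x j ≡ false) → d Data.Nat.≤ weight x

AllZeroCoordinate : ∀ {n k} → LinearCode n k → Fin n → Set
AllZeroCoordinate C j = ∀ x → x ∈C C → x j ≡ false

-- Blocks are indexed by Fin b (a collection; repeated blocks allowed);
-- inc p B = true iff point p lies in block B (this is the incidence matrix).
record Design (v b k r lam : ℕ) : Set where
  field
    inc : Fin v → Fin b → Bool
    blockSize : ∀ B → count (λ p → inc p B) ≡ k
    replication : ∀ p → count (λ B → inc p B) ≡ r
    pairs : ∀ p q → ¬ (p ≡ q) → count (λ B → inc p B ∧ inc q B) ≡ lam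

-- Rows of the augmented incidence matrix: the b incidence columns, followed
-- by one appended all-ones column (position b).
augRow : ∀ {v b k r lam} → Design v b k r lam → Fin v → Word (suc b)
augRow {b = b} D p j with Data.Fin.toℕ j Data.Nat.<? b
... | Relation.Nullary.yes j<b = Design.inc D p (Data.Fin.fromℕ< j<b)
... | Relation.Nullary.no _ = true

-- Self-orthogonality makes every codeword have even weight, so only weight 2 must be
-- excluded.  A weight-2 codeword supported on {i, j} is orthogonal to every row of the
-- augmented incidence matrix, which forces columns i and j of that matrix to coincide.
-- They cannot: a block column has weight k = 6 while the appended column has weight
-- v = 16, and a (16,6,3)-design has no repeated block.  For the latter fix a block A and
-- put x_B = |A ∩ B|; counting flags gives Σ x_B = k r = 54 and Σ x_B² = k r + k (k-1) λ
-- = 144, hence Σ (x_B - 2)² = 24, whereas a copy B ≠ A of A would contribute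
-- (x_A - 2)² + (x_B - 2)² = 32.  Finally every column of the augmented incidence matrix
-- is nonzero, so no coordinate vanishes on the whole code.
module Submission where

open import Defs
open import Data.Bool using (Bool; true; false; _∧_; _xor_; not; if_then_else_)
open import Data.Bool.Properties using (∧-idem; xor-identityʳ)
open import Data.Empty using (⊥-elim)
open import Data.Fin using (Fin; zero; suc; toℕ; fromℕ; inject₁; punchIn; punchOut; _≟_)
import Data.Fin.Properties as Finₚ
open import Data.Nat using (ℕ; zero; suc; _+_; _*_; _≤_; _<?_; z≤n; s≤s; ∣_-_∣)
open import Data.Nat.Properties hiding (_≟_)
open import Algebra.Properties.Semiring.Sum +-*-semiring
  using (sum; sum-syntax; sum-cong-≗; sum-remove; sum-replicate-zero; ∑-comm; ∑-distrib-+;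
         *-distribˡ-sum; *-distribʳ-sum)
open import Data.Nat.Tactic.RingSolver using (solve-∀)
open import Algebra.Properties.CommutativeSemigroup *-commutativeSemigroup using (interchange)
open import Data.Product using (Σ; _×_; _,_)
open import Data.Sum using (inj₁; inj₂)
open import Data.Vec.Functional using (removeAt)
open import Function using (_∘_)
open import Relation.Binary.PropositionalEquality
open import Relation.Nullary using (¬_; yes; no)

indicator : Bool → ℕ
indicator b = if b then 1 else 0

indicator-∧ : ∀ a b → indicator (a ∧ b) ≡ indicator a * indicator b
indicator-∧ true  b = sym (+-identityʳ (indicator b))
indicator-∧ false b = refl

count≡∑ : ∀ {n} (f : Fin n → Bool) → count f ≡ ∑[ i < n ] indicator (f i)
count≡∑ {zero}  f = refl
count≡∑ {suc n} f = cong (indicator (f zero) +_) (count≡∑ (f ∘ suc))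

count-cong : ∀ {n} {f g : Fin n → Bool} → f ≗ g → count f ≡ count g
count-cong {zero}  f≗g = refl
count-cong {suc n} f≗g = cong₂ _+_ (cong indicator (f≗g zero)) (count-cong (f≗g ∘ suc))

count-true : ∀ n → count {n} (λ _ → true) ≡ n
count-true zero    = refl
count-true (suc n) = cong suc (count-true n)

count≡0⇒≗false : ∀ {n} (f : Fin n → Bool) → count f ≡ 0 → ∀ i → f i ≡ false
count≡0⇒≗false {suc n} f count≡0 i with f zero in f0
count≡0⇒≗false {suc n} f ()      i       | true
count≡0⇒≗false {suc n} f count≡0 zero    | false = f0
count≡0⇒≗false {suc n} f count≡0 (suc i) | false = count≡0⇒≗false (f ∘ suc) count≡0 i

∑-term-≤ : ∀ {n} (f : Fin n → ℕ) i → f i ≤ sum f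
∑-term-≤ {suc n} f i = ≤-trans (m≤m+n (f i) _) (≤-reflexive (sym (sum-remove f)))

∑-pair-≤ : ∀ {n} (f : Fin n → ℕ) {i j} → i ≢ j → f i + f j ≤ sum f
∑-pair-≤ {suc n} f {i} {j} i≢j = begin
  f i + f j                          ≡⟨ cong (λ l → f i + f l) (Finₚ.punchIn-punchOut i≢j) ⟨
  f i + f (punchIn i (punchOut i≢j)) ≤⟨ +-monoʳ-≤ (f i) (∑-term-≤ (removeAt f i) (punchOut i≢j)) ⟩
  f i + sum (removeAt f i)           ≡⟨ sum-remove f ⟨
  sum f                              ∎
  where open ≤-Reasoning

-- Both sides equal f i + g i + Σ_{j ≠ i} f j, written without subtraction.
∑-agree-off : ∀ {n} (f g : Fin n → ℕ) i → (∀ j → j ≢ i → f j ≡ g j) →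
              sum f + g i ≡ sum g + f i
∑-agree-off {suc n} f g i agree = begin
  sum f + g i                      ≡⟨ cong (_+ g i) (sum-remove f) ⟩
  f i + sum (removeAt f i) + g i   ≡⟨ cong (λ s → f i + s + g i) rest ⟩
  f i + sum (removeAt g i) + g i   ≡⟨ swap (f i) _ (g i) ⟩
  g i + sum (removeAt g i) + f i   ≡⟨ cong (_+ f i) (sum-remove g) ⟨
  sum g + f i                      ∎
  where
  open ≡-Reasoning
  rest : sum (removeAt f i) ≡ sum (removeAt g i)
  rest = sum-cong-≗ (λ l → agree (punchIn i l) (Finₚ.punchInᵢ≢i i l))
  swap : ∀ x y z → x + y + z ≡ z + y + x
  swap = solve-∀

∣-∣²-identity : ∀ m n → ∣ m - n ∣ * ∣ m - n ∣ + 2 * n * m ≡ m * m + n * n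
∣-∣²-identity m n with ≤-total m n
... | inj₁ m≤n with m≤n⇒∃[o]m+o≡n m≤n
...   | o , refl rewrite ∣m-m+n∣≡n m o = expand m o
  where
  expand : ∀ m o → o * o + 2 * (m + o) * m ≡ m * m + (m + o) * (m + o)
  expand = solve-∀
∣-∣²-identity m n | inj₂ n≤m with m≤n⇒∃[o]m+o≡n n≤m
...   | o , refl rewrite ∣-∣-comm (n + o) n | ∣m-m+n∣≡n n o = expand n o
  where
  expand : ∀ n o → o * o + 2 * n * (n + o) ≡ (n + o) * (n + o) + n * n
  expand = solve-∀

odd : ℕ → Bool
odd zero    = false
odd (suc n) = not (odd n)

dot-self : ∀ {n} (x : Word n) → dot x x ≡ odd (weight x)
dot-self {zero}  x = refl
dot-self {suc n} x with x zero
... | true  = cong not (dot-self (x ∘ suc))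
... | false = dot-self (x ∘ suc)

weight≡0⇒dot≡false : ∀ {n} (x y : Word n) → weight x ≡ 0 → dot x y ≡ false
weight≡0⇒dot≡false {zero}  x y w≡0 = refl
weight≡0⇒dot≡false {suc n} x y w≡0 with x zero
weight≡0⇒dot≡false {suc n} x y () | true
... | false = weight≡0⇒dot≡false (x ∘ suc) (y ∘ suc) w≡0

weight≡1⇒dot≡coordinate : ∀ {n} (x : Word n) → weight x ≡ 1 →
                           Σ (Fin n) λ i → ∀ y → dot x y ≡ y i
weight≡1⇒dot≡coordinate {suc n} x w≡1 with x zero
... | true  = zero , λ y →
  trans (cong (y zero xor_) (weight≡0⇒dot≡false (x ∘ suc) (y ∘ suc) (suc-injective w≡1))) (xor-identityʳ (y zero))
... | false with weight≡1⇒dot≡coordinate (x ∘ suc) w≡1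
...   | i , dot≡ = suc i , λ y → dot≡ (y ∘ suc)

weight≡2⇒dot≡xor : ∀ {n} (x : Word n) → weight x ≡ 2 →
                   Σ (Fin n) λ i → Σ (Fin n) λ j → i ≢ j × (∀ y → dot x y ≡ y i xor y j)
weight≡2⇒dot≡xor {suc n} x w≡2 with x zero
... | true with weight≡1⇒dot≡coordinate (x ∘ suc) (suc-injective w≡2)
...   | j , dot≡ = zero , suc j , (λ ()) , λ y → cong (y zero xor_) (dot≡ (y ∘ suc))
weight≡2⇒dot≡xor {suc n} x w≡2 | false with weight≡2⇒dot≡xor (x ∘ suc) w≡2
...   | i , j , i≢j , dot≡ = suc i , suc j , i≢j ∘ Finₚ.suc-injective , λ y → dot≡ (y ∘ suc)

xor≡false⇒≡ : ∀ a b → a xor b ≡ false → a ≡ b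
xor≡false⇒≡ true  true  _ = refl
xor≡false⇒≡ false false _ = refl

minimumDistance≥4 : ∀ {m n k} (C : LinearCode n k) → SelfOrthogonal C →
                    (R : Fin m → Word n) → (∀ p → R p ∈C C) →
                    (∀ i j → i ≢ j → ¬ (∀ p → R p i ≡ R p j)) →
                    MinDistAtLeast C 4
minimumDistance≥4 C selfOrth R R∈C distinct x x∈C x≢0
  with weight x in w | trans (sym (dot-self x)) (selfOrth x x x∈C x∈C)
-- Abstracting weight x also turns the parity fact into odd w ≡ false, refuting w = 1 and w = 3.
... | 0 | _ = ⊥-elim (x≢0 (count≡0⇒≗false x w))
... | 1 | ()
... | 3 | ()
... | suc (suc (suc (suc _))) | _ = s≤s (s≤s (s≤s (s≤s z≤n)))
... | 2 | _ with weight≡2⇒dot≡xor x w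
...   | i , j , i≢j , dot≡ = ⊥-elim (distinct i j i≢j λ p →
          xor≡false⇒≡ _ _ (trans (sym (dot≡ (R p))) (selfOrth x (R p) x∈C (R∈C p))))

Simple : ∀ {v b k r lam} → Design v b k r lam → Set
Simple {b = b} D = ∀ (A B : Fin b) → (∀ p → inc p A ≡ inc p B) → A ≡ B
  where open Design D

module Intersections {v b k r lam} (D : Design v b k r lam) (A : Fin b) where
  open Design D

  meet : Fin b → ℕ
  meet B = count (λ p → inc p A ∧ inc p B)

  meet-copy : ∀ {B} → (∀ p → inc p A ≡ inc p B) → meet B ≡ k
  meet-copy same =
    trans (count-cong (λ p → trans (cong (inc p A ∧_) (sym (same p))) (∧-idem (inc p A)))) (blockSize A)

  private
    e : Fin v → ℕ
    e p = indicator (inc p A)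

    I : Fin v → Fin b → ℕ
    I p B = indicator (inc p B)

    both : Fin v → Fin b → ℕ
    both p B = e p * I p B

    N : Fin v → Fin v → ℕ
    N p q = ∑[ B < b ] (I p B * I q B)

    N-count : ∀ p q → N p q ≡ count (λ B → inc p B ∧ inc q B)
    N-count p q = sym (trans (count≡∑ (λ B → inc p B ∧ inc q B))
                             (sum-cong-≗ (λ B → indicator-∧ (inc p B) (inc q B))))

    N-diag : ∀ p → N p p ≡ r
    N-diag p = trans (N-count p p) (trans (count-cong (λ B → ∧-idem (inc p B))) (replication p))

    N-off : ∀ p q → p ≢ q → N p q ≡ lam
    N-off p q p≢q = trans (N-count p q) (pairs p q p≢q)

    ∑-e : ∑[ p < v ] e p ≡ k
    ∑-e = trans (sym (count≡∑ (λ p → inc p A))) (blockSize A)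

    ∑-I : ∀ p → ∑[ B < b ] I p B ≡ r
    ∑-I p = trans (sym (count≡∑ (inc p))) (replication p)

    meet≡∑ : ∀ B → meet B ≡ ∑[ p < v ] both p B
    meet≡∑ B = trans (count≡∑ (λ p → inc p A ∧ inc p B)) (sum-cong-≗ (λ p → indicator-∧ (inc p A) (inc p B)))

    S : Fin v → ℕ
    S p = ∑[ q < v ] (e q * N p q)

    S+lam : ∀ p → inc p A ≡ true → S p + lam ≡ r + k * lam
    S+lam p p∈A = begin
      S p + lam                       ≡⟨ cong (S p +_) (trans (cong (_* lam) e-p) (*-identityˡ lam)) ⟨
      S p + e p * lam                 ≡⟨ ∑-agree-off (λ q → e q * N p q) (λ q → e q * lam) p off-diagonal ⟩
      ∑[ q < v ] (e q * lam) + e p * N p p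
        ≡⟨ cong₂ _+_ (trans (sym (*-distribʳ-sum lam e)) (cong (_* lam) ∑-e)) (cong₂ _*_ e-p (N-diag p)) ⟩
      k * lam + 1 * r                 ≡⟨ cong (k * lam +_) (*-identityˡ r) ⟩
      k * lam + r                     ≡⟨ +-comm (k * lam) r ⟩
      r + k * lam                     ∎
      where
      open ≡-Reasoning
      e-p : e p ≡ 1
      e-p = cong indicator p∈A
      off-diagonal : ∀ q → q ≢ p → e q * N p q ≡ e q * lam
      off-diagonal q q≢p = cong (e q *_) (N-off p q (q≢p ∘ sym))

    e*[S+lam] : ∀ p → e p * (S p + lam) ≡ e p * (r + k * lam)
    e*[S+lam] p with inc p A in p∈A
    ... | false = refl
    ... | true  = cong (1 *_) (S+lam p p∈A)

    meet-square : ∀ B → meet B * meet B ≡ ∑[ p < v ] ∑[ q < v ] (both p B * both q B)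
    meet-square B = begin
      meet B * meet B                                  ≡⟨ cong₂ _*_ (meet≡∑ B) (meet≡∑ B) ⟩
      ∑[ p < v ] both p B * ∑[ q < v ] both q B        ≡⟨ *-distribʳ-sum (∑[ q < v ] both q B) (λ p → both p B) ⟩
      ∑[ p < v ] (both p B * ∑[ q < v ] both q B)      ≡⟨ sum-cong-≗ (λ p → *-distribˡ-sum (both p B) (λ q → both q B)) ⟩
      ∑[ p < v ] ∑[ q < v ] (both p B * both q B)      ∎
      where open ≡-Reasoning

    ∑-both*both : ∀ p q → ∑[ B < b ] (both p B * both q B) ≡ e p * (e q * N p q)
    ∑-both*both p q = begin
      ∑[ B < b ] (both p B * both q B)          ≡⟨ sum-cong-≗ (λ B → interchange (e p) (I p B) (e q) (I q B)) ⟩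
      ∑[ B < b ] (e p * e q * (I p B * I q B))  ≡⟨ *-distribˡ-sum (e p * e q) (λ B → I p B * I q B) ⟨
      e p * e q * N p q                         ≡⟨ *-assoc (e p) (e q) (N p q) ⟩
      e p * (e q * N p q)                       ∎
      where open ≡-Reasoning

    ∑-meet²≡∑-e*S : ∑[ B < b ] (meet B * meet B) ≡ ∑[ p < v ] (e p * S p)
    ∑-meet²≡∑-e*S = begin
      ∑[ B < b ] (meet B * meet B)                         ≡⟨ sum-cong-≗ meet-square ⟩
      ∑[ B < b ] ∑[ p < v ] ∑[ q < v ] (both p B * both q B)
        ≡⟨ ∑-comm (λ B p → ∑[ q < v ] (both p B * both q B)) ⟩
      ∑[ p < v ] ∑[ B < b ] ∑[ q < v ] (both p B * both q B)
        ≡⟨ sum-cong-≗ (λ p → ∑-comm (λ B q → both p B * both q B)) ⟩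
      ∑[ p < v ] ∑[ q < v ] ∑[ B < b ] (both p B * both q B)
        ≡⟨ sum-cong-≗ (λ p → sum-cong-≗ (∑-both*both p)) ⟩
      ∑[ p < v ] ∑[ q < v ] (e p * (e q * N p q))          ≡⟨ sum-cong-≗ (λ p → *-distribˡ-sum (e p) (λ q → e q * N p q)) ⟨
      ∑[ p < v ] (e p * S p)                               ∎
      where open ≡-Reasoning

  ∑-meet : ∑[ B < b ] meet B ≡ k * r
  ∑-meet = begin
    ∑[ B < b ] meet B                      ≡⟨ sum-cong-≗ meet≡∑ ⟩
    ∑[ B < b ] ∑[ p < v ] both p B         ≡⟨ ∑-comm (λ B p → both p B) ⟩
    ∑[ p < v ] ∑[ B < b ] both p B         ≡⟨ sum-cong-≗ (λ p → *-distribˡ-sum (e p) (I p)) ⟨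
    ∑[ p < v ] (e p * ∑[ B < b ] I p B)    ≡⟨ sum-cong-≗ (λ p → cong (e p *_) (∑-I p)) ⟩
    ∑[ p < v ] (e p * r)                   ≡⟨ *-distribʳ-sum r e ⟨
    ∑[ p < v ] e p * r                     ≡⟨ cong (_* r) ∑-e ⟩
    k * r                                  ∎
    where open ≡-Reasoning

  ∑-meet² : ∑[ B < b ] (meet B * meet B) + k * lam ≡ k * (r + k * lam)
  ∑-meet² = begin
    ∑[ B < b ] (meet B * meet B) + k * lam
      ≡⟨ cong₂ _+_ ∑-meet²≡∑-e*S (trans (cong (_* lam) (sym ∑-e)) (*-distribʳ-sum lam e)) ⟩
    ∑[ p < v ] (e p * S p) + ∑[ p < v ] (e p * lam)  ≡⟨ ∑-distrib-+ (λ p → e p * S p) (λ p → e p * lam) ⟨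
    ∑[ p < v ] (e p * S p + e p * lam)               ≡⟨ sum-cong-≗ (λ p → *-distribˡ-+ (e p) (S p) lam) ⟨
    ∑[ p < v ] (e p * (S p + lam))                   ≡⟨ sum-cong-≗ e*[S+lam] ⟩
    ∑[ p < v ] (e p * (r + k * lam))                 ≡⟨ *-distribʳ-sum (r + k * lam) e ⟨
    ∑[ p < v ] e p * (r + k * lam)                   ≡⟨ cong (_* (r + k * lam)) ∑-e ⟩
    k * (r + k * lam)                                ∎
    where open ≡-Reasoning

design-16-6-3-simple : (D : Design 16 24 6 9 3) → Simple D
design-16-6-3-simple D A B same with A ≟ B
... | yes A≡B = A≡B
... | no  A≢B = ⊥-elim (<⇒≱ (m≤m+n 241 7) (begin
  16 + 16 + 216                          ≡⟨ cong₂ (λ x y → deviation x + deviation y + 216) meet-A meet-B ⟨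
  deviation (meet A) + deviation (meet B) + 216
                                         ≤⟨ +-monoˡ-≤ 216 (∑-pair-≤ (deviation ∘ meet) A≢B) ⟩
  ∑[ C < 24 ] deviation (meet C) + 216   ≡⟨ ∑-deviation ⟩
  ∑[ C < 24 ] (meet C * meet C) + 96     ≡⟨ cong (_+ 96) (+-cancelʳ-≡ 18 _ 144 ∑-meet²) ⟩
  240                                    ∎))
  where
  open Intersections D A
  open ≤-Reasoning

  meet-A : meet A ≡ 6
  meet-A = meet-copy (λ _ → refl)

  meet-B : meet B ≡ 6
  meet-B = meet-copy same

  deviation : ℕ → ℕ
  deviation m = ∣ m - 2 ∣ * ∣ m - 2 ∣

  ∑-deviation : ∑[ C < 24 ] deviation (meet C) + 216 ≡ ∑[ C < 24 ] (meet C * meet C) + 96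
  ∑-deviation = begin-equality
    ∑dev + 216                                 ≡⟨ cong (∑dev +_) (cong (4 *_) ∑-meet) ⟨
    ∑dev + 4 * ∑[ C < 24 ] meet C              ≡⟨ cong (∑dev +_) (*-distribˡ-sum 4 meet) ⟩
    ∑dev + ∑[ C < 24 ] (4 * meet C)            ≡⟨ ∑-distrib-+ (deviation ∘ meet) (λ C → 4 * meet C) ⟨
    ∑[ C < 24 ] (deviation (meet C) + 4 * meet C)
                                               ≡⟨ sum-cong-≗ (λ C → ∣-∣²-identity (meet C) 2) ⟩
    ∑[ C < 24 ] (meet C * meet C + 4)          ≡⟨ ∑-distrib-+ (λ C → meet C * meet C) (λ _ → 4) ⟩
    ∑[ C < 24 ] (meet C * meet C) + 96         ∎
    where
    ∑dev : ℕ
    ∑dev = ∑[ C < 24 ] deviation (meet C)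

data InjectOrLast : ∀ {n} → Fin (suc n) → Set where
  inject : ∀ {n} (i : Fin n) → InjectOrLast (inject₁ i)
  last   : ∀ {n} → InjectOrLast (fromℕ n)

inject-or-last : ∀ {n} (j : Fin (suc n)) → InjectOrLast j
inject-or-last {zero}  zero    = last
inject-or-last {suc n} zero    = inject zero
inject-or-last {suc n} (suc j) with inject-or-last j
... | inject i = inject (suc i)
... | last     = last

module Augmented {v b k r lam} (D : Design v b k r lam) where
  open Design D

  augRow-inject₁ : ∀ p B → augRow D p (inject₁ B) ≡ inc p B
  augRow-inject₁ p B with toℕ (inject₁ B) <? b
  ... | yes lt = cong (inc p) (Finₚ.toℕ-injective (trans (Finₚ.toℕ-fromℕ< lt) (Finₚ.toℕ-inject₁ B)))
  ... | no ¬lt = ⊥-elim (¬lt (Finₚ.inject₁ℕ< B))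

  augRow-last : ∀ p → augRow D p (fromℕ b) ≡ true
  augRow-last p with toℕ (fromℕ b) <? b
  ... | yes lt = ⊥-elim (<-irrefl (Finₚ.toℕ-fromℕ b) lt)
  ... | no _   = refl

  block-all-true⇒k≡v : ∀ B → (∀ p → inc p B ≡ true) → k ≡ v
  block-all-true⇒k≡v B all-true = trans (sym (blockSize B)) (trans (count-cong all-true) (count-true v))

  augRow-columns-distinct : Simple D → k ≢ v → ∀ i j → i ≢ j → ¬ (∀ p → augRow D p i ≡ augRow D p j)
  augRow-columns-distinct simple k≢v i j i≢j same with inject-or-last i | inject-or-last j
  ... | inject A | inject B = i≢j (cong inject₁ (simple A B λ p →
    trans (sym (augRow-inject₁ p A)) (trans (same p) (augRow-inject₁ p B))))
  ... | inject A | last     = k≢v (block-all-true⇒k≡v A λ p →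
    trans (sym (augRow-inject₁ p A)) (trans (same p) (augRow-last p)))
  ... | last     | inject B = k≢v (block-all-true⇒k≡v B λ p →
    trans (sym (augRow-inject₁ p B)) (trans (sym (same p)) (augRow-last p)))
  ... | last     | last     = i≢j refl

  augRow-column-nonzero : Fin v → k ≢ 0 → ∀ j → ¬ (∀ p → augRow D p j ≡ false)
  augRow-column-nonzero p₀ k≢0 j all-false with inject-or-last j
  ... | inject B = k≢0 (begin
    k                           ≡⟨ blockSize B ⟨
    count (λ p → inc p B)       ≡⟨ count-cong (λ p → trans (sym (augRow-inject₁ p B)) (all-false p)) ⟩
    count {v} (λ _ → false)     ≡⟨ count≡∑ {v} (λ _ → false) ⟩
    ∑[ p < v ] 0                ≡⟨ sum-replicate-zero v ⟩
    0                           ∎)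
    where open ≡-Reasoning
  ... | last with trans (sym (augRow-last p₀)) (all-false p₀)
  ...   | ()

theorem2 : (C : LinearCode 25 12) → SelfOrthogonal C → (D : Design 16 24 6 9 3)
    → (∀ p → augRow D p ∈C C)
    → MinDistAtLeast C 4 × (∀ j → ¬ AllZeroCoordinate C j)
theorem2 C selfOrth D rows∈C =
  minimumDistance≥4 C selfOrth (augRow D) rows∈C
    (augRow-columns-distinct (design-16-6-3-simple D) (λ ())) ,
  λ j all-zero → augRow-column-nonzero zero (λ ()) j (λ p → all-zero (augRow D p) (rows∈C p))
  where open Augmented D
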